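{- Let $k\geq1$. The linear map $\alpha_k:\mathbf{FQSym}^{(k)}\to\mathrm{PM}_k^{(N)}$ defined on $k$-colored permutations $(\sigma,c)$ of size $n$ by $\alpha_k(\mathbf F_{(\sigma,c)})=\mathbf F_{M^{(\sigma,c)}}$, where $M^{(\sigma,c)}$ is the $n\times n$ matrix with $M^{(\sigma,c)}_{ij}=c_j$ if $\sigma_j=i$ and $M^{(\sigma,c)}_{ij}=0$ otherwise, is an injective Hopf algebra morphism.
   Context: Let $\mathbb K$ be a field of characteristic zero and $A_k=\{0,1,\dots,k\}$. A $k$-packed matrix of size $n\ge0$ is an $n\times n$ matrix with entries in $A_k$ such that every row and column contains a nonzero entry. $\mathrm{PM}_k^{(N)}$ is the vector space with basis $\{\mathbf F_M\}$ indexed by $k$-packed matrices, graded by size. Let $Z_a^b$ be the $a\times b$ zero matrix; for $M_1,M_2$ of sizes $n_1,n_2$, $M_1\circ n_2=\begin{bmatrix}M_1\\ Z_{n_2}^{n_1}\end{bmatrix}$, $n_1\circ M_2=\begin{bmatrix}Z_{n_1}^{n_2}\\ M_2\end{bmatrix}$; $M_1\sqcup\!\sqcup M_2$ is the set of matrices whose sequence of columns is a shuffle of the columns of $M_1\circ n_2$ with those of $n_1\circ M_2$; product $\mathbf F_{M_1}\cdot\mathbf F_{M_2}=\sum_{M\in M_1\sqcup\!\sqcup M_2}\mathbf F_M$. $\mathrm{cp}(N)$ deletes all zero rows and columns of $N$; for $M$ of size $n$ and $0\le j\le n$, $M=[L\mid R]$ ($L$ the first $j$ columns) is a column decomposition $M=L\bullet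 R$ if $\mathrm{cp}(L),\mathrm{cp}(R)$ are square; coproduct $\Delta(\mathbf F_M)=\sum_{M=L\bullet R}\mathbf F_{\mathrm{cp}(L)}\otimes\mathbf F_{\mathrm{cp}(R)}$; this is a Hopf algebra. A $k$-colored permutation of size $n$ is a pair $(\sigma,c)$ with $\sigma$ a permutation of $\{1,\dots,n\}$ (written as the word $\sigma_1\cdots\sigma_n$) and $c=c_1\cdots c_n$ a word over $\{1,\dots,k\}$; view it as the colored word $(\sigma_1,c_1)\cdots(\sigma_n,c_n)$. $\mathbf{FQSym}^{(k)}$ (Novelli–Thibon) is the Hopf algebra with basis $\{\mathbf F_{(\sigma,c)}\}$ graded by size, product $\mathbf F_{(\sigma,c)}\cdot\mathbf F_{(\tau,d)}=\sum\mathbf F_{w}$ over all colored words $w$ obtained by shuffling $(\sigma_1,c_1)\cdots(\sigma_n,c_n)$ with $(\tau_1+n,d_1)\cdots(\tau_m+n,d_m)$ ($m$ the size of $\tau$), and coproduct $\Delta\mathbf F_{(\sigma,c)}=\sum_{i=0}^n\mathbf F_{(\mathrm{std}(\sigma_1\cdots\sigma_i),c_1\cdots c_i)}\otimes\mathbf F_{(\mathrm{std}(\sigma_{i+1}\cdots\sigma_n),c_{i+1}\cdots c_n)}$, where $\mathrm{std}$ replaces a word of distinct integers by the permutation with the same relative order. -}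

module Defs where

open import Level using (Level; _⊔_) renaming (suc to lsuc)
open import Algebra.Bundles using (CommutativeRing)
open import Data.Nat using () renaming (_+_ to _+ℕ_)
open import Data.Nat using (ℕ; zero; suc; _≡ᵇ_; _≤ᵇ_; _<ᵇ_)
open import Data.Fin using (Fin; toℕ) renaming (zero to fz; suc to fs)
open import Data.Bool using (Bool; true; false; _∧_; _∨_; not; if_then_else_; T)
open import Data.List.Relation.Unary.All using (All)
open import Data.List using (List; []; _∷_; _++_; map; length; concatMap;
  replicate; take; drop; upTo; applyUpTo; filterᵇ; zip; foldr)
open import Data.Product using (Σ; _×_; _,_; proj₁; proj₂)
open import Relation.Nullary using (¬_)
open import Relation.Binary.PropositionalEquality using (_≡_)

record Field c ℓ : Set (lsuc (c ⊔ ℓ)) where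
  field
    commutativeRing : CommutativeRing c ℓ
  open CommutativeRing commutativeRing public
  field
    1≉0     : ¬ (1# ≈ 0#)
    inverse : ∀ x → ¬ (x ≈ 0#) → Σ Carrier λ y → (x * y) ≈ 1#

module _ {c ℓ} (K : Field c ℓ) where
  open Field K
  natK : ℕ → Carrier
  natK zero    = 0#
  natK (suc n) = 1# + natK n

  CharZero : Set ℓ
  CharZero = ∀ n → natK n ≈ 0# → n ≡ 0

shuffles : {A : Set} → List A → List A → List (List A)
shuffles []       ys       = ys ∷ []
shuffles (x ∷ xs) []       = (x ∷ xs) ∷ []
shuffles (x ∷ xs) (y ∷ ys) =
  map (x ∷_) (shuffles xs (y ∷ ys)) ++ map (y ∷_) (shuffles (x ∷ xs) ys)

listEq : {A : Set} → (A → A → Bool) → List A → List A → Bool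
listEq eq []       []       = true
listEq eq (x ∷ xs) (y ∷ ys) = eq x y ∧ listEq eq xs ys
listEq eq _        _        = false

allᵇ : {A : Set} → (A → Bool) → List A → Bool
allᵇ p []       = true
allᵇ p (x ∷ xs) = p x ∧ allᵇ p xs

anyᵇ : {A : Set} → (A → Bool) → List A → Bool
anyᵇ p []       = false
anyᵇ p (x ∷ xs) = p x ∨ anyᵇ p xs

finEq : ∀ {n} → Fin n → Fin n → Bool
finEq a b = toℕ a ≡ᵇ toℕ b

distinct : List ℕ → Bool
distinct []       = true
distinct (x ∷ xs) = not (anyᵇ (x ≡ᵇ_) xs) ∧ distinct xs

countᵇ : {A : Set} → (A → Bool) → List A → ℕ
countᵇ p xs = length (filterᵇ p xs)

select : {A : Set} → List Bool → List A → List A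
select (true ∷ bs)  (x ∷ xs) = x ∷ select bs xs
select (false ∷ bs) (x ∷ xs) = select bs xs
select _            _        = []

module Combinatorics (k : ℕ) where

  -- k-coloured permutations as coloured words (σ₁,c₁)…(σₙ,cₙ).
  -- σᵢ is a natural number (1-based); colour cᵢ ∈ {1,…,k} is encoded by
  -- an element of Fin k (the colour value is toℕ cᵢ + 1).
  CWord : Set
  CWord = List (ℕ × Fin k)

  isPerm : List ℕ → Bool
  isPerm w = distinct w ∧ allᵇ (λ x → (1 ≤ᵇ x) ∧ (x ≤ᵇ length w)) w

  isCPerm : CWord → Bool
  isCPerm w = isPerm (map proj₁ w)

  cwordEq : CWord → CWord → Bool
  cwordEq = listEq (λ p q → (proj₁ p ≡ᵇ proj₁ q) ∧ finEq (proj₂ p) (proj₂ q))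

  std : List ℕ → List ℕ
  std w = map (λ x → suc (countᵇ (λ y → y <ᵇ x) w)) w

  stdC : CWord → CWord
  stdC w = zip (std (map proj₁ w)) (map proj₂ w)

  prodF : CWord → CWord → List CWord
  prodF u v = shuffles u (map (λ p → (proj₁ p +ℕ length u , proj₂ p)) v)

  coprodF : CWord → List (CWord × CWord)
  coprodF w = map (λ i → (stdC (take i w) , stdC (drop i w))) (upTo (suc (length w)))

  -- Matrices with entries in A_k = {0,…,k} ≅ Fin (suc k), stored
  -- COLUMN-MAJOR: a matrix is the list of its columns, each column is the
  -- list of its entries from top to bottom.  Entry M_ij = (column j)[i].
  Entry : Set
  Entry = Fin (suc k)

  Mat : Set
  Mat = List (List Entry)

  isNZ : Entry → Bool
  isNZ e = not (toℕ e ≡ᵇ 0)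

  nzCol : List Entry → Bool
  nzCol col = anyᵇ isNZ col

  -- is the entry at (0-based) row i of the column nonzero?
  nzAt : List Entry → ℕ → Bool
  nzAt []       _       = false
  nzAt (e ∷ es) zero    = isNZ e
  nzAt (e ∷ es) (suc i) = nzAt es i

  rowMask : ℕ → Mat → List Bool
  rowMask r M = map (λ i → anyᵇ (λ col → nzAt col i) M) (upTo r)

  isPacked : Mat → Bool
  isPacked M = allᵇ (λ col → length col ≡ᵇ length M) M
             ∧ allᵇ nzCol M
             ∧ allᵇ (λ b → b) (rowMask (length M) M)

  matEq : Mat → Mat → Bool
  matEq = listEq (listEq finEq)

  zeroE : Entry
  zeroE = fz

  prodPM : Mat → Mat → List Mat
  prodPM M₁ M₂ =
    shuffles (map (λ col → col ++ replicate (length M₂) zeroE) M₁)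
             (map (λ col → replicate (length M₁) zeroE ++ col) M₂)

  cp : ℕ → Mat → Mat
  cp r N = map (select (rowMask r N)) (filterᵇ nzCol N)

  cpSquare : ℕ → Mat → Bool
  cpSquare r N = countᵇ nzCol N ≡ᵇ countᵇ (λ b → b) (rowMask r N)

  coprodPM : Mat → List (Mat × Mat)
  coprodPM M = concatMap decomp (upTo (suc (length M)))
    where
      r = length M
      decomp : ℕ → List (Mat × Mat)
      decomp j = if cpSquare r (take j M) ∧ cpSquare r (drop j M)
                 then (cp r (take j M) , cp r (drop j M)) ∷ []
                 else []

  matOf : CWord → Mat
  matOf w = map (λ p → map (λ i → if proj₁ p ≡ᵇ i then fs (proj₂ p) else fz)
                           (applyUpTo suc (length w)))
                w

-- An element is a finite formal linear combination, represented by a list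
-- of (coefficient, basis element); two such are equal when all their
-- coefficients agree.

module Free {c ℓ} (K : Field c ℓ) {B : Set} (eqB : B → B → Bool) where
  open Field K

  V : Set c
  V = List (Carrier × B)

  coeff : V → B → Carrier
  coeff []              b = 0#
  coeff ((a , b') ∷ xs) b = if eqB b' b then a + coeff xs b else coeff xs b

  infix 4 _≈V_
  _≈V_ : V → V → Set ℓ
  x ≈V y = ∀ b → coeff x b ≈ coeff y b

  scaleSum : Carrier → List B → V
  scaleSum a bs = map (λ b → (a , b)) bs

  bilin : (B → B → List B) → V → V → V
  bilin m x y = concatMap (λ p → concatMap (λ q → scaleSum (proj₁ p * proj₁ q) (m (proj₂ p) (proj₂ q))) y) x

  sumK : List Carrier → Carrier
  sumK = foldr _+_ 0#

  linExt : {B' : Set} → (B → List B') → V → List (Carrier × B')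
  linExt f x = concatMap (λ p → map (λ b → (proj₁ p , b)) (f (proj₂ p))) x

  linForm : (B → Carrier) → V → Carrier
  linForm f x = sumK (map (λ p → proj₁ p * f (proj₂ p)) x)

pairEq : {A B : Set} → (A → A → Bool) → (B → B → Bool) → A × B → A × B → Bool
pairEq ea eb p q = ea (proj₁ p) (proj₁ q) ∧ eb (proj₂ p) (proj₂ q)

module Hopf {c ℓ} (K : Field c ℓ) (k : ℕ) where
  open Field K
  open Combinatorics k public

  module FF  = Free K cwordEq
  module FF2 = Free K (pairEq cwordEq cwordEq)
  module PP  = Free K matEq
  module PP2 = Free K (pairEq matEq matEq)

  FQSym : Set c
  FQSym = FF.V

  FQSym⊗FQSym : Set c
  FQSym⊗FQSym = FF2.V

  ValidF : FQSym → Set c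
  ValidF x = All (λ p → T (isCPerm (proj₂ p))) x

  _·F_ : FQSym → FQSym → FQSym
  _·F_ = FF.bilin prodF

  ΔF : FQSym → FQSym⊗FQSym
  ΔF = FF.linExt coprodF

  oneF : FQSym
  oneF = (1# , []) ∷ []

  εF : FQSym → Carrier
  εF = FF.linForm (λ w → if length w ≡ᵇ 0 then 1# else 0#)

  PM : Set c
  PM = PP.V

  PM⊗PM : Set c
  PM⊗PM = PP2.V

  _·PM_ : PM → PM → PM
  _·PM_ = PP.bilin prodPM

  ΔPM : PM → PM⊗PM
  ΔPM = PP.linExt coprodPM

  onePM : PM
  onePM = (1# , []) ∷ []

  εPM : PM → Carrier
  εPM = PP.linForm (λ M → if length M ≡ᵇ 0 then 1# else 0#)

  α : FQSym → PM
  α = FF.linExt (λ w → matOf w ∷ [])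

  α⊗α : FQSym⊗FQSym → PM⊗PM
  α⊗α = FF2.linExt (λ p → (matOf (proj₁ p) , matOf (proj₂ p)) ∷ [])

module Submission where

-- Column j of M^(σ,c) has a single nonzero entry, c_j in row σ_j.  Hence distinct coloured
-- permutations give distinct matrices, and α_k is injective on coefficients.  Shifting the second
-- word by n in a shuffle pads the columns of the first factor with zero rows below and those of the
-- second factor with zero rows above, which is the product of PM_k.  For the coproduct every cut j is
-- a column decomposition: the nonzero rows of the first j columns are exactly σ_1,…,σ_j, so cp keeps
-- all these columns and moves row σ_i to the rank of σ_i among σ_1,…,σ_j, which is std; likewise for
-- the last n − j columns.  Everything holds as an identity of formal sums.

open import Defs
open import Data.Bool using (Bool; true; false; _∧_; _∨_; not; if_then_else_; T)
open import Data.Bool.Properties using (∧-conicalˡ; ∧-conicalʳ; ∨-conicalˡ; ∨-conicalʳ; ∨-zeroʳ; not-injective; T-≡)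
open import Data.Fin using (Fin; toℕ) renaming (zero to fz; suc to fs)
open import Data.Fin.Properties using (toℕ-injective) renaming (suc-injective to fs-injective)
open import Data.Nat using (ℕ; zero; suc; _+_; _∸_; _<_; _≤_; z≤n; s≤s; _≡ᵇ_; _<ᵇ_; _≤ᵇ_)
open import Data.Nat.Properties using (≡ᵇ⇒≡; ≤ᵇ⇒≤; <⇒<ᵇ; ≤⇒≤ᵇ; +-suc; +-comm; +-identityʳ; +-monoˡ-≤; +-∸-assoc; n∸n≡0;
  ≤-refl; ≤-trans; m≤m+n; <-irrefl; n<1+n; m<n⇒m<1+n; m<m+n; ≤∧≢⇒<; m≢1+m+n) renaming (_≟_ to _≟ℕ_)
open import Data.List using (List; []; _∷_; [_]; _++_; map; length; take; drop; filterᵇ; applyUpTo; replicate; upTo; concatMap; zip)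
open import Data.List.Properties using (map-++; map-∘; map-cong; map-cong-local; length-map; take-map; drop-map;
  ∷-injectiveˡ; ∷-injectiveʳ; concatMap-cong; concatMap-map; concatMap-pure; concatMap-++)
open import Data.List.Relation.Unary.All using (All; []; _∷_) renaming (map to all-map)
import Data.List.Relation.Unary.All as All
open import Data.List.Relation.Unary.All.Properties using (map⁺; map⁻; ++⁺; take⁺; drop⁺)
open import Data.Product using (_×_; _,_; proj₁; proj₂; map₁)
open import Function using (_∘_; _⇔_; mk⇔; Equivalence)
open import Relation.Binary.PropositionalEquality using (_≡_; _≢_; refl; sym; trans; cong; cong₂; subst; module ≡-Reasoning)
open import Relation.Nullary using (yes; no; contradiction)

T⇒≡true : ∀ {b} → T b → b ≡ true
T⇒≡true = Equivalence.to T-≡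

≡true⇒T : ∀ {b} → b ≡ true → T b
≡true⇒T = Equivalence.from T-≡

≡true⇒≡ : ∀ {a b} → (a ≡ true → b ≡ true) → (b ≡ true → a ≡ true) → a ≡ b
≡true⇒≡ {false} {false} _ _ = refl
≡true⇒≡ {false} {true}  _ b⇒a = b⇒a refl
≡true⇒≡ {true}  {_}     a⇒b _ = sym (a⇒b refl)

≡ᵇ-refl : ∀ n → (n ≡ᵇ n) ≡ true
≡ᵇ-refl zero    = refl
≡ᵇ-refl (suc n) = ≡ᵇ-refl n

≡ᵇ-true⇒≡ : ∀ m n → (m ≡ᵇ n) ≡ true → m ≡ n
≡ᵇ-true⇒≡ m n e = ≡ᵇ⇒≡ m n (≡true⇒T e)

≢⇒≡ᵇ-false : ∀ {m n} → m ≢ n → (m ≡ᵇ n) ≡ false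
≢⇒≡ᵇ-false {m} {n} m≢n with m ≡ᵇ n in eq
... | true  = contradiction (≡ᵇ-true⇒≡ m n eq) m≢n
... | false = refl

≡ᵇ-sym : ∀ m n → (m ≡ᵇ n) ≡ (n ≡ᵇ m)
≡ᵇ-sym zero    zero    = refl
≡ᵇ-sym zero    (suc n) = refl
≡ᵇ-sym (suc m) zero    = refl
≡ᵇ-sym (suc m) (suc n) = ≡ᵇ-sym m n

+-cancelˡ-≡ᵇ : ∀ n s t → (n + s ≡ᵇ n + t) ≡ (s ≡ᵇ t)
+-cancelˡ-≡ᵇ zero    s t = refl
+-cancelˡ-≡ᵇ (suc n) s t = +-cancelˡ-≡ᵇ n s t

DecidesEq : {A : Set} → (A → A → Bool) → Set
DecidesEq {A} eq = ∀ (x y : A) → (eq x y ≡ true) ⇔ (x ≡ y)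

≡ᵇ-decidesEq : DecidesEq _≡ᵇ_
≡ᵇ-decidesEq m n = mk⇔ (≡ᵇ-true⇒≡ m n) λ { refl → ≡ᵇ-refl m }

finEq-decidesEq : ∀ {n} → DecidesEq (finEq {n})
finEq-decidesEq a b = mk⇔ (toℕ-injective ∘ ≡ᵇ-true⇒≡ (toℕ a) (toℕ b)) λ { refl → ≡ᵇ-refl (toℕ a) }

pairEq-decidesEq : ∀ {A B : Set} {eqA : A → A → Bool} {eqB : B → B → Bool} →
  DecidesEq eqA → DecidesEq eqB → DecidesEq (pairEq eqA eqB)
pairEq-decidesEq decA decB (a , b) (a' , b') = mk⇔
  (λ e → cong₂ _,_ (Equivalence.to (decA a a') (∧-conicalˡ _ _ e)) (Equivalence.to (decB b b') (∧-conicalʳ _ _ e)))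
  λ { refl → cong₂ _∧_ (Equivalence.from (decA a a) refl) (Equivalence.from (decB b b) refl) }

listEq-decidesEq : ∀ {A : Set} {eq : A → A → Bool} → DecidesEq eq → DecidesEq (listEq eq)
listEq-decidesEq {eq = eq} dec xs ys = mk⇔ (sound xs ys) λ { refl → complete xs }
  where
    sound : ∀ xs ys → listEq eq xs ys ≡ true → xs ≡ ys
    sound []       []       _ = refl
    sound (x ∷ xs) (y ∷ ys) e =
      cong₂ _∷_ (Equivalence.to (dec x y) (∧-conicalˡ _ _ e)) (sound xs ys (∧-conicalʳ _ _ e))
    complete : ∀ xs → listEq eq xs xs ≡ true
    complete []       = refl
    complete (x ∷ xs) = cong₂ _∧_ (Equivalence.from (dec x x) refl) (complete xs)

bit : Bool → ℕ
bit true  = 1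
bit false = 0

module _ {A : Set} (p : A → Bool) where

  countᵇ-∷ : ∀ x xs → countᵇ p (x ∷ xs) ≡ bit (p x) + countᵇ p xs
  countᵇ-∷ x xs with p x
  ... | true  = refl
  ... | false = refl

  filterᵇ-all : ∀ {xs} → All (λ x → p x ≡ true) xs → filterᵇ p xs ≡ xs
  filterᵇ-all               []        = refl
  filterᵇ-all {x ∷ xs} (px ∷ ps) rewrite px = cong (x ∷_) (filterᵇ-all ps)

  countᵇ-all : ∀ {xs} → All (λ x → p x ≡ true) xs → countᵇ p xs ≡ length xs
  countᵇ-all ps = cong length (filterᵇ-all ps)

  select-map : ∀ {B : Set} (g : A → B) xs → select (map p xs) (map g xs) ≡ map g (filterᵇ p xs)
  select-map g []       = refl
  select-map g (x ∷ xs) with p x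
  ... | true  = cong (g x ∷_) (select-map g xs)
  ... | false = select-map g xs

countᵇ-cong : ∀ {A : Set} {p q : A → Bool} {xs} → All (λ x → p x ≡ q x) xs → countᵇ p xs ≡ countᵇ q xs
countᵇ-cong {p = p} {q} {[]}     []       = refl
countᵇ-cong {p = p} {q} {x ∷ xs} (e ∷ es) =
  trans (countᵇ-∷ p x xs) (trans (cong₂ (λ b n → bit b + n) e (countᵇ-cong es)) (sym (countᵇ-∷ q x xs)))

countᵇ-map : ∀ {A B : Set} (p : B → Bool) (f : A → B) xs → countᵇ p (map f xs) ≡ countᵇ (p ∘ f) xs
countᵇ-map p f []       = refl
countᵇ-map p f (x ∷ xs) with p (f x)
... | true  = cong suc (countᵇ-map p f xs)
... | false = countᵇ-map p f xs

countᵇ-∨ : ∀ {A : Set} (p q : A → Bool) → (∀ x → p x ∧ q x ≡ false) → ∀ xs →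
           countᵇ (λ x → p x ∨ q x) xs ≡ countᵇ p xs + countᵇ q xs
countᵇ-∨ p q disj []       = refl
countᵇ-∨ p q disj (x ∷ xs) with p x | q x | disj x | countᵇ-∨ p q disj xs
... | true  | true  | () | _
... | true  | false | _  | ih = cong suc ih
... | false | true  | _  | ih = trans (cong suc ih) (sym (+-suc _ _))
... | false | false | _  | ih = ih

anyᵇ-cong : ∀ {A : Set} {p q : A → Bool} → (∀ x → p x ≡ q x) → ∀ xs → anyᵇ p xs ≡ anyᵇ q xs
anyᵇ-cong p≗q []       = refl
anyᵇ-cong p≗q (x ∷ xs) = cong₂ _∨_ (p≗q x) (anyᵇ-cong p≗q xs)

anyᵇ-map : ∀ {A B : Set} (p : B → Bool) (f : A → B) xs → anyᵇ p (map f xs) ≡ anyᵇ (p ∘ f) xs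
anyᵇ-map p f []       = refl
anyᵇ-map p f (x ∷ xs) = cong (p (f x) ∨_) (anyᵇ-map p f xs)

anyᵇ-∧ : ∀ {A : Set} b (p : A → Bool) xs → anyᵇ (λ x → b ∧ p x) xs ≡ b ∧ anyᵇ p xs
anyᵇ-∧ true  p xs       = refl
anyᵇ-∧ false p []       = refl
anyᵇ-∧ false p (x ∷ xs) = anyᵇ-∧ false p xs

anyᵇ-take : ∀ {A : Set} (p : A → Bool) i xs → anyᵇ p xs ≡ false → anyᵇ p (take i xs) ≡ false
anyᵇ-take p zero    xs       _ = refl
anyᵇ-take p (suc i) []       _ = refl
anyᵇ-take p (suc i) (x ∷ xs) e = cong₂ _∨_ (∨-conicalˡ _ _ e) (anyᵇ-take p i xs (∨-conicalʳ _ _ e))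

distinct-take : ∀ i xs → distinct xs ≡ true → distinct (take i xs) ≡ true
distinct-take zero    xs       _ = refl
distinct-take (suc i) []       _ = refl
distinct-take (suc i) (x ∷ xs) d =
  cong₂ _∧_ (cong not (anyᵇ-take (x ≡ᵇ_) i xs (not-injective (∧-conicalˡ _ _ d))))
            (distinct-take i xs (∧-conicalʳ _ _ d))

distinct-drop : ∀ i xs → distinct xs ≡ true → distinct (drop i xs) ≡ true
distinct-drop zero    xs       d = d
distinct-drop (suc i) []       _ = refl
distinct-drop (suc i) (x ∷ xs) d = distinct-drop i xs (∧-conicalʳ _ _ d)

range : ℕ → ℕ → List ℕ
range a zero    = []
range a (suc n) = a ∷ range (suc a) n

applyUpTo≡range : ∀ (f : ℕ → ℕ) a n → (∀ i → f i ≡ a + i) → applyUpTo f n ≡ range a n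
applyUpTo≡range f a zero    _  = refl
applyUpTo≡range f a (suc n) f≗ =
  cong₂ _∷_ (trans (f≗ 0) (+-identityʳ a))
            (applyUpTo≡range (f ∘ suc) (suc a) n (λ i → trans (f≗ (suc i)) (+-suc a i)))

range-++ : ∀ a n m → range a (n + m) ≡ range a n ++ range (a + n) m
range-++ a zero    m = cong (λ b → range b m) (sym (+-identityʳ a))
range-++ a (suc n) m = cong (a ∷_) (trans (range-++ (suc a) n m) (cong (λ b → range (suc a) n ++ range b m) (sym (+-suc a n))))

shuffles-map : ∀ {A B : Set} (f : A → B) xs ys → shuffles (map f xs) (map f ys) ≡ map (map f) (shuffles xs ys)
shuffles-map f []       ys       = refl
shuffles-map f (x ∷ xs) []       = refl
shuffles-map f (x ∷ xs) (y ∷ ys) = begin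
    map (f x ∷_) (shuffles (map f xs) (map f (y ∷ ys))) ++ map (f y ∷_) (shuffles (map f (x ∷ xs)) (map f ys))
  ≡⟨ cong₂ _++_ (cong (map (f x ∷_)) (shuffles-map f xs (y ∷ ys))) (cong (map (f y ∷_)) (shuffles-map f (x ∷ xs) ys)) ⟩
    map (f x ∷_) (map (map f) L) ++ map (f y ∷_) (map (map f) R)
  ≡⟨ cong₂ _++_ (trans (sym (map-∘ L)) (map-∘ L)) (trans (sym (map-∘ R)) (map-∘ R)) ⟩
    map (map f) (map (x ∷_) L) ++ map (map f) (map (y ∷_) R)
  ≡⟨ sym (map-++ (map f) (map (x ∷_) L) (map (y ∷_) R)) ⟩
    map (map f) (map (x ∷_) L ++ map (y ∷_) R)
  ∎
  where
    open ≡-Reasoning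
    L = shuffles xs (y ∷ ys)
    R = shuffles (x ∷ xs) ys

shuffles-length : ∀ {A : Set} (xs ys : List A) → All (λ zs → length zs ≡ length xs + length ys) (shuffles xs ys)
shuffles-length []       ys       = refl ∷ []
shuffles-length (x ∷ xs) []       = cong suc (sym (+-identityʳ (length xs))) ∷ []
shuffles-length (x ∷ xs) (y ∷ ys) =
  ++⁺ (map⁺ (all-map (cong suc) (shuffles-length xs (y ∷ ys))))
      (map⁺ (all-map (λ e → trans (cong suc e) (sym (+-suc (suc (length xs)) (length ys)))) (shuffles-length (x ∷ xs) ys)))

map-injectiveOn : ∀ {A B : Set} (f : A → B) {xs ys} → All (λ x → ∀ y → f x ≡ f y → x ≡ y) xs →
                  map f xs ≡ map f ys → xs ≡ ys
map-injectiveOn f {[]}     {[]}     []         _  = refl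
map-injectiveOn f {x ∷ xs} {y ∷ ys} (inj ∷ is) eq =
  cong₂ _∷_ (inj y (∷-injectiveˡ eq)) (map-injectiveOn f is (∷-injectiveʳ eq))

concatMap-singleton : ∀ {A B : Set} {f : A → List B} (g : A → B) → (∀ x → f x ≡ g x ∷ []) → ∀ xs → concatMap f xs ≡ map g xs
concatMap-singleton g f≗ xs = trans (concatMap-cong f≗ xs) (trans (sym (concatMap-map [_] g xs)) (concatMap-pure (map g xs)))

zip-map-proj : ∀ {A B C : Set} (f : A → C) (xs : List (A × B)) → zip (map f (map proj₁ xs)) (map proj₂ xs) ≡ map (map₁ f) xs
zip-map-proj f []       = refl
zip-map-proj f (x ∷ xs) = cong (map₁ f x ∷_) (zip-map-proj f xs)

memᵇ : List ℕ → ℕ → Bool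
memᵇ P i = anyᵇ (_≡ᵇ i) P

memᵇ-self : ∀ P → All (λ y → memᵇ P y ≡ true) P
memᵇ-self []      = []
memᵇ-self (y ∷ P) = cong (_∨ memᵇ P y) (≡ᵇ-refl y) ∷ all-map (λ {z} e → trans (cong ((y ≡ᵇ z) ∨_) e) (∨-zeroʳ _)) (memᵇ-self P)

inRangeᵇ : ℕ → ℕ → ℕ → Bool
inRangeᵇ a len y = (a ≤ᵇ y) ∧ (y <ᵇ a + len)

≤ᵇ≡<ᵇ-suc : ∀ a y → (a ≤ᵇ y) ≡ (a <ᵇ suc y)
≤ᵇ≡<ᵇ-suc zero    y = refl
≤ᵇ≡<ᵇ-suc (suc a) y = refl

≢⇒<ᵇ≡≤ᵇ : ∀ a y → y ≢ a → (a <ᵇ y) ≡ (a ≤ᵇ y)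
≢⇒<ᵇ≡≤ᵇ zero    zero    y≢a = contradiction refl y≢a
≢⇒<ᵇ≡≤ᵇ zero    (suc y) _   = refl
≢⇒<ᵇ≡≤ᵇ (suc a) zero    _   = refl
≢⇒<ᵇ≡≤ᵇ (suc a) (suc y) y≢a = trans (≢⇒<ᵇ≡≤ᵇ a y (y≢a ∘ cong suc)) (≤ᵇ≡<ᵇ-suc a y)

≤ᵇ∧>ᵇ≡false : ∀ a y → (a ≤ᵇ y) ∧ (y <ᵇ a) ≡ false
≤ᵇ∧>ᵇ≡false zero    y       = refl
≤ᵇ∧>ᵇ≡false (suc a) zero    = refl
≤ᵇ∧>ᵇ≡false (suc a) (suc y) = trans (cong (_∧ (y <ᵇ a)) (sym (≤ᵇ≡<ᵇ-suc a y))) (≤ᵇ∧>ᵇ≡false a y)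

countᵇ-≡ᵇ-range-below : ∀ {y} a len → y < a → countᵇ (y ≡ᵇ_) (range a len) ≡ 0
countᵇ-≡ᵇ-range-below a zero    _   = refl
countᵇ-≡ᵇ-range-below a (suc len) y<a
  rewrite ≢⇒≡ᵇ-false (λ y≡a → <-irrefl y≡a y<a) = countᵇ-≡ᵇ-range-below (suc a) len (m<n⇒m<1+n y<a)

countᵇ-≡ᵇ-range : ∀ y a len → countᵇ (y ≡ᵇ_) (range a len) ≡ bit (inRangeᵇ a len y)
countᵇ-≡ᵇ-range y a zero = cong bit (sym (trans (cong (λ b → (a ≤ᵇ y) ∧ (y <ᵇ b)) (+-identityʳ a)) (≤ᵇ∧>ᵇ≡false a y)))
countᵇ-≡ᵇ-range y a (suc len) with y ≟ℕ a
... | yes refl rewrite ≡ᵇ-refl y | countᵇ-≡ᵇ-range-below (suc y) len (n<1+n y)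
                     | T⇒≡true (≤⇒≤ᵇ (≤-refl {y})) | T⇒≡true (<⇒<ᵇ (m<m+n y (s≤s (z≤n {len})))) = refl
... | no y≢a rewrite ≢⇒≡ᵇ-false y≢a =
  trans (countᵇ-≡ᵇ-range y (suc a) len) (cong bit (cong₂ _∧_ (≢⇒<ᵇ≡≤ᵇ a y y≢a) (cong (y <ᵇ_) (sym (+-suc a len)))))

countᵇ-memᵇ-range : ∀ P a len → distinct P ≡ true → countᵇ (memᵇ P) (range a len) ≡ countᵇ (inRangeᵇ a len) P
countᵇ-memᵇ-range []      a len _ = none (range a len)
  where
    none : ∀ xs → countᵇ (memᵇ []) xs ≡ 0
    none []       = refl
    none (_ ∷ xs) = none xs
countᵇ-memᵇ-range (y ∷ P) a len d = begin
    countᵇ (λ i → (y ≡ᵇ i) ∨ memᵇ P i) (range a len)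
  ≡⟨ countᵇ-∨ (y ≡ᵇ_) (memᵇ P) disjoint (range a len) ⟩
    countᵇ (y ≡ᵇ_) (range a len) + countᵇ (memᵇ P) (range a len)
  ≡⟨ cong₂ _+_ (countᵇ-≡ᵇ-range y a len) (countᵇ-memᵇ-range P a len (∧-conicalʳ _ _ d)) ⟩
    bit (inRangeᵇ a len y) + countᵇ (inRangeᵇ a len) P
  ≡⟨ sym (countᵇ-∷ (inRangeᵇ a len) y P) ⟩
    countᵇ (inRangeᵇ a len) (y ∷ P)
  ∎
  where
    open ≡-Reasoning
    y∉P : memᵇ P y ≡ false
    y∉P = trans (anyᵇ-cong (λ z → ≡ᵇ-sym z y) P) (not-injective (∧-conicalˡ _ _ d))
    disjoint : ∀ i → (y ≡ᵇ i) ∧ memᵇ P i ≡ false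
    disjoint i with y ≡ᵇ i in y≡ᵇi
    ... | false = refl
    ... | true  = subst (λ z → memᵇ P z ≡ false) (≡ᵇ-true⇒≡ y i y≡ᵇi) y∉P

inRangeᵇ-from-1 : ∀ {y s} → 1 ≤ y → 1 ≤ s → inRangeᵇ 1 (s ∸ 1) y ≡ (y <ᵇ s)
inRangeᵇ-from-1 {suc y} {suc s} _ _ = refl

module ColouredMatrices (k : ℕ) where
  open Combinatorics k

  entry : ℕ → Fin k → ℕ → Entry
  entry s c i = if s ≡ᵇ i then fs c else fz

  column : ℕ → ℕ × Fin k → List Entry
  column n (s , c) = map (entry s c) (range 1 n)

  matOf-columns : ∀ w → matOf w ≡ map (column (length w)) w
  matOf-columns w = map-cong (λ p → cong (map (entry (proj₁ p) (proj₂ p))) (applyUpTo≡range suc 1 n λ _ → refl)) w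
    where n = length w

  length-matOf : ∀ w → length (matOf w) ≡ length w
  length-matOf w = length-map _ w

  entry-self : ∀ s c → entry s c s ≡ fs c
  entry-self s c rewrite ≡ᵇ-refl s = refl

  entry-other : ∀ {s i} c → s ≢ i → entry s c i ≡ fz
  entry-other c s≢i rewrite ≢⇒≡ᵇ-false s≢i = refl

  isNZ-entry : ∀ s c i → isNZ (entry s c i) ≡ (s ≡ᵇ i)
  isNZ-entry s c i with s ≡ᵇ i
  ... | true  = refl
  ... | false = refl

  InRange : ℕ → ℕ × Fin k → Set
  InRange n (s , _) = 1 ≤ s × s ≤ n

  isCPerm⇒ : ∀ w → T (isCPerm w) → distinct (map proj₁ w) ≡ true × All (InRange (length w)) w
  isCPerm⇒ w t = ∧-conicalˡ _ _ (T⇒≡true t) , bounds w (∧-conicalʳ _ _ (T⇒≡true t))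
    where
      bounds : ∀ ws → allᵇ (λ x → (1 ≤ᵇ x) ∧ (x ≤ᵇ length (map proj₁ w))) (map proj₁ ws) ≡ true → All (InRange (length w)) ws
      bounds []       _ = []
      bounds (p ∷ ws) e = (≤ᵇ⇒≤ 1 _ (≡true⇒T (∧-conicalˡ _ _ h)) ,
                           subst (proj₁ p ≤_) (length-map proj₁ w) (≤ᵇ⇒≤ _ _ (≡true⇒T (∧-conicalʳ _ _ h))))
                          ∷ bounds ws (∧-conicalʳ _ _ e)
        where h = ∧-conicalˡ _ _ e

  map-range-≡⇒≡ : ∀ {B : Set} (g h : ℕ → B) a len s →
    map g (range a len) ≡ map h (range a len) → a ≤ s → s < a + len → g s ≡ h s
  map-range-≡⇒≡ g h a zero      s _  a≤s s<a+0 =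
    contradiction (≤-trans s<a+0 (subst (_≤ s) (sym (+-identityʳ a)) a≤s)) (<-irrefl refl)
  map-range-≡⇒≡ g h a (suc len) s eq a≤s s<a+len with s ≟ℕ a
  ... | yes refl = ∷-injectiveˡ eq
  ... | no  s≢a  = map-range-≡⇒≡ g h (suc a) len s (∷-injectiveʳ eq)
                     (≤∧≢⇒< a≤s (s≢a ∘ sym)) (subst (s <_) (+-suc a len) s<a+len)

  column-injective : ∀ n p q → InRange n p → column n p ≡ column n q → p ≡ q
  column-injective n (s , c) (t , d) (1≤s , s≤n) eq
    with t ≟ℕ s | map-range-≡⇒≡ (entry s c) (entry t d) 1 n s eq 1≤s (s≤s s≤n)
  ... | yes refl | c≡d = cong (s ,_) (fs-injective (trans (sym (entry-self s c)) (trans c≡d (entry-self s d))))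
  ... | no  t≢s  | c≡d with () ← trans (sym (entry-self s c)) (trans c≡d (entry-other d t≢s))

  matOf-injective : ∀ w b → All (InRange (length w)) w → matOf w ≡ matOf b → w ≡ b
  matOf-injective w b bounded eq = map-injectiveOn (column n) (all-map (λ h q → column-injective n _ q h) bounded) columns≡
    where
      open ≡-Reasoning
      n = length w
      columns≡ : map (column n) w ≡ map (column n) b
      columns≡ = begin
        map (column n) w                ≡⟨ sym (matOf-columns w) ⟩
        matOf w                         ≡⟨ eq ⟩
        matOf b                         ≡⟨ matOf-columns b ⟩
        map (column (length b)) b       ≡⟨ cong (λ m → map (column m) b) (trans (sym (length-matOf b)) (trans (cong length (sym eq)) (length-matOf w))) ⟩
        map (column n) b                ∎

  matEq-matOf : ∀ w b → All (InRange (length w)) w → matEq (matOf w) (matOf b) ≡ cwordEq w b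
  matEq-matOf w b bounded = ≡true⇒≡
    (λ e → Equivalence.from (cwordEq-decidesEq w b) (matOf-injective w b bounded (Equivalence.to (matEq-decidesEq _ _) e)))
    (λ e → Equivalence.from (matEq-decidesEq _ _) (cong matOf (Equivalence.to (cwordEq-decidesEq w b) e)))
    where
      cwordEq-decidesEq : DecidesEq cwordEq
      cwordEq-decidesEq = listEq-decidesEq (pairEq-decidesEq ≡ᵇ-decidesEq finEq-decidesEq)
      matEq-decidesEq : DecidesEq matEq
      matEq-decidesEq = listEq-decidesEq (listEq-decidesEq finEq-decidesEq)

  entries-below : ∀ {s} c a len → s < a → map (entry s c) (range a len) ≡ replicate len fz
  entries-below c a zero      _   = refl
  entries-below c a (suc len) s<a =
    cong₂ _∷_ (entry-other c (λ s≡a → <-irrefl s≡a s<a)) (entries-below c (suc a) len (m<n⇒m<1+n s<a))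

  entries-above : ∀ {s} c a len → a + len ≤ s → map (entry s c) (range a len) ≡ replicate len fz
  entries-above c a zero      _         = refl
  entries-above {s} c a (suc len) a+len≤s =
    cong₂ _∷_ (entry-other c (λ s≡a → <-irrefl (sym s≡a) (≤-trans (s≤s (m≤m+n a len)) 1+a+len≤s)))
              (entries-above c (suc a) len 1+a+len≤s)
    where
      1+a+len≤s : suc a + len ≤ s
      1+a+len≤s = subst (_≤ s) (+-suc a len) a+len≤s

  entries-shift : ∀ n t c a len → map (entry (n + t) c) (range (n + a) len) ≡ map (entry t c) (range a len)
  entries-shift n t c a zero      = refl
  entries-shift n t c a (suc len) =
    cong₂ _∷_ (cong (λ b → if b then fs c else fz) (+-cancelˡ-≡ᵇ n t a))
              (trans (cong (λ b → map (entry (n + t) c) (range b len)) (sym (+-suc n a))) (entries-shift n t c (suc a) len))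

  column-padBelow : ∀ n m {p} → proj₁ p ≤ n → column (n + m) p ≡ column n p ++ replicate m fz
  column-padBelow n m {s , c} s≤n = begin
    map (entry s c) (range 1 (n + m))                              ≡⟨ cong (map (entry s c)) (range-++ 1 n m) ⟩
    map (entry s c) (range 1 n ++ range (suc n) m)                 ≡⟨ map-++ (entry s c) (range 1 n) _ ⟩
    column n (s , c) ++ map (entry s c) (range (suc n) m)          ≡⟨ cong (column n (s , c) ++_) (entries-below c (suc n) m (s≤s s≤n)) ⟩
    column n (s , c) ++ replicate m fz                             ∎
    where open ≡-Reasoning

  column-padAbove : ∀ n m {t} d → 1 ≤ t → column (n + m) (t + n , d) ≡ replicate n fz ++ column m (t , d)
  column-padAbove n m {t} d 1≤t = begin
    map (entry (t + n) d) (range 1 (n + m))                        ≡⟨ cong (map (entry (t + n) d)) (range-++ 1 n m) ⟩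
    map (entry (t + n) d) (range 1 n ++ range (suc n) m)           ≡⟨ map-++ (entry (t + n) d) (range 1 n) _ ⟩
    map (entry (t + n) d) (range 1 n) ++ map (entry (t + n) d) (range (suc n) m)
      ≡⟨ cong₂ _++_ (entries-above d 1 n (+-monoˡ-≤ n 1≤t))
                    (trans (cong₂ (λ s a → map (entry s d) (range a m)) (+-comm t n) (+-comm 1 n)) (entries-shift n t d 1 m)) ⟩
    replicate n fz ++ column m (t , d)                             ∎
    where open ≡-Reasoning

  matOf-shuffles : ∀ u v → All (InRange (length u)) u → All (λ p → 1 ≤ proj₁ p) v →
                   map matOf (prodF u v) ≡ prodPM (matOf u) (matOf v)
  matOf-shuffles u v u-bounded v-positive = begin
    map matOf (shuffles u v′)                                    ≡⟨ map-cong-local (all-map shuffle-columns (shuffles-length u v′)) ⟩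
    map (map (column (n + m))) (shuffles u v′)                    ≡⟨ sym (shuffles-map (column (n + m)) u v′) ⟩
    shuffles (map (column (n + m)) u) (map (column (n + m)) v′)   ≡⟨ cong₂ shuffles lower upper ⟩
    prodPM (matOf u) (matOf v)                                    ∎
    where
      open ≡-Reasoning
      n = length u
      m = length v
      shift : ℕ × Fin k → ℕ × Fin k
      shift (t , d) = (t + n , d)
      v′ = map shift v
      shuffle-columns : ∀ {w} → length w ≡ n + length v′ → matOf w ≡ map (column (n + m)) w
      shuffle-columns {w} len = trans (matOf-columns w) (cong (λ l → map (column l) w) (trans len (cong (n +_) (length-map shift v))))
      lower : map (column (n + m)) u ≡ map (_++ replicate (length (matOf v)) zeroE) (matOf u)
      lower = begin
        map (column (n + m)) u                                ≡⟨ map-cong-local (all-map (λ b → column-padBelow n m (proj₂ b)) u-bounded) ⟩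
        map ((_++ replicate m fz) ∘ column n) u               ≡⟨ map-∘ u ⟩
        map (_++ replicate m fz) (map (column n) u)           ≡⟨ cong₂ (λ l M → map (_++ replicate l fz) M) (sym (length-matOf v)) (sym (matOf-columns u)) ⟩
        map (_++ replicate (length (matOf v)) zeroE) (matOf u) ∎
      upper : map (column (n + m)) v′ ≡ map (replicate (length (matOf u)) zeroE ++_) (matOf v)
      upper = begin
        map (column (n + m)) v′                               ≡⟨ sym (map-∘ v) ⟩
        map (column (n + m) ∘ shift) v                        ≡⟨ map-cong-local (all-map (column-padAbove n m _) v-positive) ⟩
        map ((replicate n fz ++_) ∘ column m) v               ≡⟨ map-∘ v ⟩
        map (replicate n fz ++_) (map (column m) v)           ≡⟨ cong₂ (λ l M → map (replicate l fz ++_) M) (sym (length-matOf u)) (sym (matOf-columns v)) ⟩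
        map (replicate (length (matOf u)) zeroE ++_) (matOf v) ∎

  entries-below-filter : ∀ (m : ℕ → Bool) {s} c a len → s < a →
    map (entry s c) (filterᵇ m (range a len)) ≡ replicate (countᵇ m (range a len)) fz
  entries-below-filter m c a zero      _   = refl
  entries-below-filter m c a (suc len) s<a with m a
  ... | true  = cong₂ _∷_ (entry-other c (λ s≡a → <-irrefl s≡a s<a)) (entries-below-filter m c (suc a) len (m<n⇒m<1+n s<a))
  ... | false = entries-below-filter m c (suc a) len (m<n⇒m<1+n s<a)

  -- Deleting the rows outside m moves the nonzero entry from row s to row r + (number of kept rows in [a, s)).
  entries-filter : ∀ (m : ℕ → Bool) {s} c a len r → m s ≡ true → a ≤ s →
    map (entry s c) (filterᵇ m (range a len))
      ≡ map (entry (r + countᵇ m (range a (s ∸ a))) c) (range r (countᵇ m (range a len)))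
  entries-filter m c a zero r _ _ = refl
  entries-filter m {s} c a (suc len) r ms a≤s with a ≟ℕ s | m a in ma
  ... | yes refl | false = contradiction (trans (sym ms) ma) λ ()
  ... | yes refl | true rewrite n∸n≡0 s | +-identityʳ r =
    cong₂ _∷_ (trans (entry-self s c) (sym (entry-self r c)))
              (trans (entries-below-filter m c (suc s) len (n<1+n s)) (sym (entries-below c (suc r) _ (n<1+n r))))
  ... | no a≢s | false rewrite +-∸-assoc 1 (≤∧≢⇒< a≤s a≢s) | ma = entries-filter m c (suc a) len r ms (≤∧≢⇒< a≤s a≢s)
  ... | no a≢s | true rewrite +-∸-assoc 1 (≤∧≢⇒< a≤s a≢s) | ma =
    cong₂ _∷_ (trans (entry-other c (a≢s ∘ sym)) (sym (entry-other c r+1+X≢r)))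
              (trans (entries-filter m c (suc a) len (suc r) ms (≤∧≢⇒< a≤s a≢s))
                     (cong (λ x → map (entry x c) (range (suc r) (countᵇ m (range (suc a) len)))) (sym (+-suc r X))))
    where
      X = countᵇ m (range (suc a) (s ∸ suc a))
      r+1+X≢r : r + suc X ≢ r
      r+1+X≢r e = m≢1+m+n r (trans (sym e) (+-suc r X))

  nzAt-entries : ∀ s c a len i → nzAt (map (entry s c) (range a len)) i ≡ (i <ᵇ len) ∧ (s ≡ᵇ a + i)
  nzAt-entries s c a zero      i       = refl
  nzAt-entries s c a (suc len) zero    = trans (isNZ-entry s c a) (cong (s ≡ᵇ_) (sym (+-identityʳ a)))
  nzAt-entries s c a (suc len) (suc i) =
    trans (nzAt-entries s c (suc a) len i) (cong (λ b → (i <ᵇ len) ∧ (s ≡ᵇ b)) (sym (+-suc a i)))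

  anyᵇ-≡ᵇ-range : ∀ s a len → a ≤ s → s < a + len → anyᵇ (s ≡ᵇ_) (range a len) ≡ true
  anyᵇ-≡ᵇ-range s a zero      a≤s s<a+0 =
    contradiction (≤-trans s<a+0 (subst (_≤ s) (sym (+-identityʳ a)) a≤s)) (<-irrefl refl)
  anyᵇ-≡ᵇ-range s a (suc len) a≤s s<a+len with s ≟ℕ a
  ... | yes refl = cong (_∨ anyᵇ (s ≡ᵇ_) (range (suc s) len)) (≡ᵇ-refl s)
  ... | no  s≢a  rewrite ≢⇒≡ᵇ-false s≢a =
    anyᵇ-≡ᵇ-range s (suc a) len (≤∧≢⇒< a≤s (s≢a ∘ sym)) (subst (s <_) (+-suc a len) s<a+len)

  column-nonzero : ∀ n p → InRange n p → nzCol (column n p) ≡ true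
  column-nonzero n (s , c) (1≤s , s≤n) =
    trans (anyᵇ-map isNZ (entry s c) (range 1 n))
          (trans (anyᵇ-cong (isNZ-entry s c) (range 1 n)) (anyᵇ-≡ᵇ-range s 1 n 1≤s (s≤s s≤n)))

  rowMask-columns : ∀ n ws → rowMask n (map (column n) ws) ≡ map (memᵇ (map proj₁ ws)) (range 1 n)
  rowMask-columns n ws = begin
    map (λ i → anyᵇ (λ col → nzAt col i) (map (column n) ws)) (upTo n)   ≡⟨ map-cong row (upTo n) ⟩
    map (λ i → (i <ᵇ n) ∧ memᵇ P (suc i)) (upTo n)                       ≡⟨ cong (map _) (applyUpTo≡range (λ i → i) 0 n (λ _ → refl)) ⟩
    map (λ i → (i <ᵇ n) ∧ memᵇ P (suc i)) (range 0 n)                    ≡⟨ drop-guard 0 n ≤-refl ⟩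
    map (memᵇ P) (range 1 n)                                            ∎
    where
      open ≡-Reasoning
      P = map proj₁ ws
      row : ∀ i → anyᵇ (λ col → nzAt col i) (map (column n) ws) ≡ (i <ᵇ n) ∧ memᵇ P (suc i)
      row i = begin
        anyᵇ (λ col → nzAt col i) (map (column n) ws)           ≡⟨ anyᵇ-map _ (column n) ws ⟩
        anyᵇ (λ p → nzAt (column n p) i) ws                     ≡⟨ anyᵇ-cong (λ p → nzAt-entries (proj₁ p) (proj₂ p) 1 n i) ws ⟩
        anyᵇ (λ p → (i <ᵇ n) ∧ (proj₁ p ≡ᵇ suc i)) ws           ≡⟨ anyᵇ-∧ (i <ᵇ n) _ ws ⟩
        (i <ᵇ n) ∧ anyᵇ (λ p → proj₁ p ≡ᵇ suc i) ws             ≡⟨ cong ((i <ᵇ n) ∧_) (sym (anyᵇ-map (_≡ᵇ suc i) proj₁ ws)) ⟩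
        (i <ᵇ n) ∧ memᵇ P (suc i)                               ∎
      drop-guard : ∀ a len → a + len ≤ n →
        map (λ i → (i <ᵇ n) ∧ memᵇ P (suc i)) (range a len) ≡ map (memᵇ P) (range (suc a) len)
      drop-guard a zero      _         = refl
      drop-guard a (suc len) a+len≤n =
        cong₂ _∷_ (cong (_∧ memᵇ P (suc a)) (T⇒≡true (<⇒<ᵇ (≤-trans (s≤s (m≤m+n a len)) 1+a+len≤n))))
                  (drop-guard (suc a) len 1+a+len≤n)
        where
          1+a+len≤n : suc a + len ≤ n
          1+a+len≤n = subst (_≤ n) (+-suc a len) a+len≤n

  module Subword (n : ℕ) (ws : CWord) (distinct-ws : distinct (map proj₁ ws) ≡ true) (bounded : All (InRange n) ws) where

    P : List ℕ
    P = map proj₁ ws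

    nonzero : All (λ col → nzCol col ≡ true) (map (column n) ws)
    nonzero = map⁺ (all-map (column-nonzero n _) bounded)

    count-rows : countᵇ (memᵇ P) (range 1 n) ≡ length ws
    count-rows = trans (countᵇ-memᵇ-range P 1 n distinct-ws)
                       (trans (countᵇ-all (inRangeᵇ 1 n) (map⁺ {f = proj₁} (all-map (λ {p} → in-range {p}) bounded))) (length-map proj₁ ws))
      where
        in-range : ∀ {p} → InRange n p → inRangeᵇ 1 n (proj₁ p) ≡ true
        in-range (1≤s , s≤n) = cong₂ _∧_ (T⇒≡true (≤⇒≤ᵇ 1≤s)) (T⇒≡true (<⇒<ᵇ (s≤s s≤n)))

    cpSquare-columns : cpSquare n (map (column n) ws) ≡ true
    cpSquare-columns = trans (cong₂ _≡ᵇ_ count-columns count-mask) (≡ᵇ-refl (length ws))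
      where
        count-columns : countᵇ nzCol (map (column n) ws) ≡ length ws
        count-columns = trans (countᵇ-all nzCol nonzero) (length-map (column n) ws)
        count-mask : countᵇ (λ b → b) (rowMask n (map (column n) ws)) ≡ length ws
        count-mask = trans (cong (countᵇ (λ b → b)) (rowMask-columns n ws))
                           (trans (countᵇ-map (λ b → b) (memᵇ P) (range 1 n)) count-rows)

    rank : ℕ × Fin k → ℕ × Fin k
    rank = map₁ (λ s → suc (countᵇ (_<ᵇ s) P))

    compress-column : ∀ p → InRange n p → memᵇ P (proj₁ p) ≡ true →
                      select (map (memᵇ P) (range 1 n)) (column n p) ≡ column (length ws) (rank p)
    compress-column (s , c) (1≤s , _) s∈P = begin
      select (map (memᵇ P) (range 1 n)) (map (entry s c) (range 1 n))
        ≡⟨ select-map (memᵇ P) (entry s c) (range 1 n) ⟩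
      map (entry s c) (filterᵇ (memᵇ P) (range 1 n))
        ≡⟨ entries-filter (memᵇ P) c 1 n 1 s∈P 1≤s ⟩
      map (entry (suc (countᵇ (memᵇ P) (range 1 (s ∸ 1)))) c) (range 1 (countᵇ (memᵇ P) (range 1 n)))
        ≡⟨ cong₂ (λ x l → map (entry (suc x) c) (range 1 l)) rank≡ count-rows ⟩
      column (length ws) (rank (s , c))
        ∎
      where
        open ≡-Reasoning
        rank≡ : countᵇ (memᵇ P) (range 1 (s ∸ 1)) ≡ countᵇ (_<ᵇ s) P
        rank≡ = trans (countᵇ-memᵇ-range P 1 (s ∸ 1) distinct-ws)
                      (countᵇ-cong (map⁺ (all-map (λ b → inRangeᵇ-from-1 (proj₁ b) 1≤s) bounded)))

    cp-columns : cp n (map (column n) ws) ≡ matOf (stdC ws)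
    cp-columns = begin
      map (select (rowMask n (map (column n) ws))) (filterᵇ nzCol (map (column n) ws))
        ≡⟨ cong₂ (λ mask cols → map (select mask) cols) (rowMask-columns n ws) (filterᵇ-all nzCol nonzero) ⟩
      map (select mask) (map (column n) ws)          ≡⟨ sym (map-∘ ws) ⟩
      map (select mask ∘ column n) ws                ≡⟨ map-cong-local (all-map (λ (b , p∈P) → compress-column _ b p∈P) (All.zip (bounded , map⁻ (memᵇ-self P)))) ⟩
      map (column (length ws) ∘ rank) ws             ≡⟨ map-∘ ws ⟩
      map (column (length ws)) (map rank ws)         ≡⟨ cong (λ l → map (column l) (map rank ws)) (sym (length-map rank ws)) ⟩
      map (column (length (map rank ws))) (map rank ws) ≡⟨ cong (λ M → map (column (length M)) M) (sym (zip-map-proj _ ws)) ⟩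
      map (column (length (stdC ws))) (stdC ws)      ≡⟨ sym (matOf-columns (stdC ws)) ⟩
      matOf (stdC ws)                                ∎
      where
        open ≡-Reasoning
        mask = map (memᵇ P) (range 1 n)

  coprodPM-matOf : ∀ w → distinct (map proj₁ w) ≡ true → All (InRange (length w)) w →
    coprodPM (matOf w) ≡ map (λ j → (matOf (stdC (take j w)) , matOf (stdC (drop j w)))) (upTo (suc (length w)))
  coprodPM-matOf w distinct-w bounded =
    trans (cong (λ r → concatMap (cut r) (upTo (suc r))) (length-matOf w)) (concatMap-singleton _ cut≡ (upTo (suc n)))
    where
      n = length w
      M = matOf w
      -- the function local to the definition of coprodPM, so that the first step holds by unfolding
      cut : ℕ → ℕ → List (Mat × Mat)
      cut r j = if cpSquare r (take j M) ∧ cpSquare r (drop j M) then (cp r (take j M) , cp r (drop j M)) ∷ [] else []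
      module Left j = Subword n (take j w) (subst (λ P → distinct P ≡ true) (take-map j w) (distinct-take j _ distinct-w)) (take⁺ j bounded)
      module Right j = Subword n (drop j w) (subst (λ P → distinct P ≡ true) (drop-map j w) (distinct-drop j _ distinct-w)) (drop⁺ j bounded)
      cut≡ : ∀ j → cut n j ≡ (matOf (stdC (take j w)) , matOf (stdC (drop j w))) ∷ []
      cut≡ j rewrite trans (cong (take j) (matOf-columns w)) (take-map j w) | trans (cong (drop j) (matOf-columns w)) (drop-map j w)
                   | Left.cpSquare-columns j | Right.cpSquare-columns j =
        cong₂ (λ L R → (L , R) ∷ []) (Left.cp-columns j) (Right.cp-columns j)

≡⇒≈V : ∀ {c ℓ} (K : Field c ℓ) {B : Set} {eqB : B → B → Bool} {x y : Free.V K eqB} → x ≡ y → Free._≈V_ K eqB x y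
≡⇒≈V K refl _ = Field.refl K

module AlphaMorphism {c ℓ} (K : Field c ℓ) (k : ℕ) where
  open Hopf K k
  open ColouredMatrices k
  open Field K using (reflexive; 1#; 0#) renaming (_+_ to _+K_; _*_ to _*K_; trans to ≈-trans)

  α-++ : ∀ x y → α (x ++ y) ≡ α x ++ α y
  α-++ = concatMap-++ _

  α-scaleSum : ∀ a ws → α (FF.scaleSum a ws) ≡ PP.scaleSum a (map matOf ws)
  α-scaleSum a []       = refl
  α-scaleSum a (w ∷ ws) = cong (_ ∷_) (α-scaleSum a ws)

  α-·F : ∀ x y → ValidF x → ValidF y → α (x ·F y) ≡ α x ·PM α y
  α-·F []            y _                   _       = refl
  α-·F ((a , u) ∷ x) y (valid-u ∷ valid-x) valid-y =
    trans (α-++ (row y) (x ·F y)) (cong₂ _++_ (α-row y valid-y) (α-·F x y valid-x valid-y))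
    where
      row : FQSym → FQSym
      row = concatMap (λ q → FF.scaleSum (a *K proj₁ q) (prodF u (proj₂ q)))
      α-row : ∀ y → ValidF y → α (row y) ≡ concatMap (λ q → PP.scaleSum (a *K proj₁ q) (prodPM (matOf u) (proj₂ q))) (α y)
      α-row []            _                   = refl
      α-row ((b , v) ∷ y) (valid-v ∷ valid-y) =
        trans (α-++ (FF.scaleSum (a *K b) (prodF u v)) (row y))
          (cong₂ _++_ (trans (α-scaleSum (a *K b) (prodF u v))
                             (cong (PP.scaleSum (a *K b)) (matOf-shuffles u v (proj₂ (isCPerm⇒ u valid-u))
                                                            (all-map proj₁ (proj₂ (isCPerm⇒ v valid-v))))))
                      (α-row y valid-y))

  α⊗α-++ : ∀ x y → α⊗α (x ++ y) ≡ α⊗α x ++ α⊗α y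
  α⊗α-++ = concatMap-++ _

  α⊗α-scaled : ∀ a (ps : List (CWord × CWord)) →
    α⊗α (map (a ,_) ps) ≡ map (a ,_) (map (λ (u , v) → (matOf u , matOf v)) ps)
  α⊗α-scaled a []       = refl
  α⊗α-scaled a (p ∷ ps) = cong (_ ∷_) (α⊗α-scaled a ps)

  ΔPM-α : ∀ x → ValidF x → ΔPM (α x) ≡ α⊗α (ΔF x)
  ΔPM-α []            _                   = refl
  ΔPM-α ((a , w) ∷ x) (valid-w ∷ valid-x) = begin
    map (a ,_) (coprodPM (matOf w)) ++ ΔPM (α x)
      ≡⟨ cong₂ _++_ (cong (map (a ,_)) (trans (coprodPM-matOf w (proj₁ perm) (proj₂ perm)) (map-∘ (upTo _)))) (ΔPM-α x valid-x) ⟩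
    map (a ,_) (map (λ (u , v) → (matOf u , matOf v)) (coprodF w)) ++ α⊗α (ΔF x)
      ≡⟨ cong (_++ α⊗α (ΔF x)) (sym (α⊗α-scaled a (coprodF w))) ⟩
    α⊗α (map (a ,_) (coprodF w)) ++ α⊗α (ΔF x)
      ≡⟨ sym (α⊗α-++ (map (a ,_) (coprodF w)) (ΔF x)) ⟩
    α⊗α (ΔF ((a , w) ∷ x))
      ∎
    where
      open ≡-Reasoning
      perm = isCPerm⇒ w valid-w

  εPM-α : ∀ x → εPM (α x) ≡ εF x
  εPM-α []            = refl
  εPM-α ((a , w) ∷ x) =
    cong₂ _+K_ (cong (λ l → a *K (if l ≡ᵇ 0 then 1# else 0#)) (length-matOf w)) (εPM-α x)

  coeff-α : ∀ x w → ValidF x → PP.coeff (α x) (matOf w) ≡ FF.coeff x w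
  coeff-α []            w _                   = refl
  coeff-α ((a , u) ∷ x) w (valid-u ∷ valid-x) =
    cong₂ (λ b z → if b then a +K z else z) (matEq-matOf u w (proj₂ (isCPerm⇒ u valid-u))) (coeff-α x w valid-x)

  α-injective : ∀ x y → ValidF x → ValidF y → PP._≈V_ (α x) (α y) → FF._≈V_ x y
  α-injective x y valid-x valid-y αx≈αy w =
    ≈-trans (reflexive (sym (coeff-α x w valid-x))) (≈-trans (αx≈αy (matOf w)) (reflexive (coeff-α y w valid-y)))

proposition3p1 : ∀ {c ℓ} (K : Field c ℓ) → CharZero K → (k : ℕ) → 1 ≤ k →
    let open Hopf K k in
    let open Field K in
    (∀ x y → ValidF x → ValidF y → PP._≈V_ (α x) (α y) → FF._≈V_ x y)
    × (∀ x y → ValidF x → ValidF y → PP._≈V_ (α (x ·F y)) (α x ·PM α y))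
    × PP._≈V_ (α oneF) onePM
    × (∀ x → ValidF x → PP2._≈V_ (ΔPM (α x)) (α⊗α (ΔF x)))
    × (∀ x → ValidF x → εPM (α x) ≈ εF x)
proposition3p1 K _ k _ =
    α-injective
  , (λ x y valid-x valid-y → ≡⇒≈V K (α-·F x y valid-x valid-y))
  , (λ _ → Field.refl K)
  , (λ x valid-x → ≡⇒≈V K (ΔPM-α x valid-x))
  , (λ x _ → Field.reflexive K (εPM-α x))
  where open AlphaMorphism K k
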